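{- Let $G$ be a finite connected graph and let $H$ be an induced subgraph of $G$ which is a terminal block of $G$. If $H$ is $(3,3,\tfrac13)$-reductive, then $H$ is a $(3,\varepsilon,\alpha)$-reducible subgraph of $G$ for all values $0<\varepsilon\le\alpha\le\tfrac13$.
   Context: For a connected graph $G$, a cut vertex is a vertex whose removal disconnects $G$; a block is a maximal connected induced subgraph with no cut vertex (i.e. maximal 2-connected or a $K_2$); a terminal block is a block containing at most one cut vertex of $G$. For $f:V(H)\to\mathbb N$, an $f$-assignment on $H$ maps each $v$ to a set $L(v)$ of $f(v)$ colors; an $L$-coloring is a proper coloring with $\phi(v)\in L(v)$. For $k\ge3$, $0<\alpha\le1/k$, $H$ is $(f,k,\alpha)$-reductive if for every $f$-assignment $L$ on $H$ there is a probability distribution on $L$-colorings $\phi$ of $H$ with (FIX) $\Pr(\phi(v)=c)\ge\alpha$ for all $v$, $c\in L(v)$, and (FORB) for all $U\subseteq V(H)$ with $|U|\le k-2$ and $c\in\bigcup_{u\in U}L(u)$, $\Pr(\phi(u)\ne c\ \forall u\in U)\ge\alpha$. "$(3,3,\tfrac13)$-reductive" means $(f,3,\tfrac13)$-reductive with $f\equiv3$. For $0<\varepsilon\le\alpha$ and a list assignment $L$ on $G$, a distribution on $L$-colorings $\phi$ of $G$ is a $(3,\varepsilon,\alpha)$-distribution if $\Pr(\phi(v)=c)\ge\varepsilon$ for all $v$, $c\in L(v)$, and $\Pr(\phi(u)\neq c)\ge\alpha$ for every vertex $u$ and color $c$. An induced subgraph $H$ of $G$ is a $(3,\varepsilon,\alpha)$-reducible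 subgraph of $G$ if there is a nonempty $S\subseteq V(H)$ such that for every $3$-assignment $L$ on $G$, the existence of a $(3,\varepsilon,\alpha)$-distribution on $L$-colorings of $G\setminus S$ implies the existence of a $(3,\varepsilon,\alpha)$-distribution on $L$-colorings of $G$.
   Formalization: The parameters ε and α range over the rationals, and every probability distribution on L-colourings assigns rational probabilities. -}

module Defs where

open import Data.Nat as ℕ using (ℕ; suc)
open import Data.Bool using (Bool; true; false; not; _∧_; _∨_)
open import Data.Fin using (Fin)
open import Data.Fin.Subset using (Subset; _∈_; _⊆_; ⊤; ∁; _-_; ∣_∣; Nonempty)
open import Data.Fin.Subset.Properties using (_∈?_)
open import Data.List using (List; []; _∷_; length; foldr; allFin)
open import Data.List.Membership.Propositional using () renaming (_∈_ to _∈ₗ_)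
open import Data.List.Relation.Unary.All using (All)
open import Data.List.Relation.Unary.Unique.Propositional using (Unique)
open import Data.Integer using (+_)
open import Data.Rational using (ℚ; 0ℚ; 1ℚ; _+_; _*_; _≤_; _<_; _/_)
open import Data.Product using (Σ; ∃; _×_; _,_; proj₁; proj₂)
open import Relation.Nullary using (¬_)
open import Relation.Nullary.Decidable using (⌊_⌋)
open import Relation.Binary.PropositionalEquality using (_≡_; _≢_)

record Graph (n : ℕ) : Set where
  field
    adj     : Fin n → Fin n → Bool
    adj-sym : ∀ u v → adj u v ≡ adj v u
    adj-irr : ∀ v → adj v v ≡ false
open Graph public

module _ {n : ℕ} (G : Graph n) where

  data Walk (W : Subset n) : Fin n → Fin n → Set where
    stay : ∀ {u} → u ∈ W → Walk W u u
    step : ∀ {u v w} → u ∈ W → adj G u v ≡ true → Walk W v w → Walk W u w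

  Connected : Subset n → Set
  Connected W = Nonempty W × (∀ u v → u ∈ W → v ∈ W → Walk W u v)

  CutVertexOf : Subset n → Fin n → Set
  CutVertexOf W v = v ∈ W × Σ (Fin n) λ a → Σ (Fin n) λ b →
    a ∈ (W - v) × b ∈ (W - v) × ¬ Walk (W - v) a b

  Blockish : Subset n → Set
  Blockish W = Connected W × (∀ v → ¬ CutVertexOf W v)

  Block : Subset n → Set
  Block B = Blockish B × (∀ B′ → B ⊆ B′ → Blockish B′ → B′ ≡ B)

  TerminalBlock : Subset n → Set
  TerminalBlock B = Block B ×
    (∀ u v → u ∈ B → v ∈ B → CutVertexOf ⊤ u → CutVertexOf ⊤ v → u ≡ v)

  ListAssignment : Set
  ListAssignment = Fin n → List ℕ

  IsAssignment : Subset n → (Fin n → ℕ) → ListAssignment → Set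
  IsAssignment W f L = ∀ v → v ∈ W → Unique (L v) × length (L v) ≡ f v

  IsLColouring : Subset n → ListAssignment → (Fin n → ℕ) → Set
  IsLColouring W L φ = (∀ v → v ∈ W → φ v ∈ₗ L v) ×
    (∀ u v → u ∈ W → v ∈ W → adj G u v ≡ true → φ u ≢ φ v)

  -- A finitely supported probability distribution on L-colourings of G[W]:
  -- a list of (weight, colouring) pairs, weights nonnegative summing to 1.
  record Distribution (W : Subset n) (L : ListAssignment) : Set where
    field
      support   : List (ℚ × (Fin n → ℕ))
      nonneg    : All (λ p → 0ℚ ≤ proj₁ p) support
      total     : foldr (λ p s → proj₁ p + s) 0ℚ support ≡ 1ℚ
      colouring : All (λ p → IsLColouring W L (proj₂ p)) support
  open Distribution public

  Pr : ∀ {W L} → Distribution W L → ((Fin n → ℕ) → Bool) → ℚ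
  Pr D E = foldr (λ p s → (if E (proj₂ p) then proj₁ p else 0ℚ) + s) 0ℚ (support D)
    where open import Data.Bool using (if_then_else_)

  evEq : Fin n → ℕ → (Fin n → ℕ) → Bool
  evEq v c φ = φ v ℕ.≡ᵇ c

  evAvoid : Subset n → ℕ → (Fin n → ℕ) → Bool
  evAvoid U c φ = foldr (λ u b → (not ⌊ u ∈? U ⌋ ∨ not (φ u ℕ.≡ᵇ c)) ∧ b) true (allFin n)

  Reductive : Subset n → (Fin n → ℕ) → ℕ → ℚ → Set
  Reductive W f k α = ∀ (L : ListAssignment) → IsAssignment W f L →
    Σ (Distribution W L) λ D →
      (∀ v c → v ∈ W → c ∈ₗ L v → α ≤ Pr D (evEq v c)) ×
      (∀ (U : Subset n) c → U ⊆ W → ∣ U ∣ ℕ.≤ k ℕ.∸ 2 →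
         (Σ (Fin n) λ u → u ∈ U × c ∈ₗ L u) → α ≤ Pr D (evAvoid U c))

  EADistribution : Subset n → ListAssignment → ℚ → ℚ → Set
  EADistribution W L ε α = Σ (Distribution W L) λ D →
    (∀ v c → v ∈ W → c ∈ₗ L v → ε ≤ Pr D (evEq v c)) ×
    (∀ u c → u ∈ W → α ≤ Pr D (λ φ → not (evEq u c φ)))

  Reducible : Subset n → ℚ → ℚ → Set
  Reducible W ε α = Σ (Subset n) λ S → Nonempty S × S ⊆ W ×
    (∀ (L : ListAssignment) → IsAssignment ⊤ (λ _ → 3) L →
       EADistribution (∁ S) L ε α → EADistribution ⊤ L ε α)

oneThird : ℚ
oneThird = + 1 / 3

-- A terminal block H of a connected graph G is either all of G, or it meets the rest of G in a
-- single cut vertex x: a vertex u ∈ H with a neighbour w ∉ H is a cut vertex of G, since a path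
-- from w back to H avoiding u would be an ear extending the block H.
--
-- In the first case the distribution for H itself works. Otherwise take S = H - x. A vertex of H
-- has three colours, each of probability at least 1/3, hence each of probability exactly 1/3.
-- Draw ψ from the given distribution on G - S and φ from the distribution for H conditioned on
-- φ(x) = ψ(x), and colour S by φ and the rest by ψ. Conditioning costs exactly a factor 3, so ψ
-- keeps its law, while a vertex v ∈ S gets colour c with probability
-- 3 E_H[1{φ(v) = c} Pr(ψ(x) = φ(x))], which lies between 3ε Pr_H(φ(v) = c) ≥ ε and
-- 3(1 - α) Pr_H(φ(v) = c) ≤ 1 - α.

module Submission where

open import Defs
open import Data.Nat as ℕ using (ℕ; zero; suc; _≡ᵇ_)
open import Data.Nat.Properties using (≡ᵇ⇒≡)
open import Data.Bool using (Bool; true; false; not; if_then_else_; T)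
open import Data.Fin using (Fin; _≟_)
open import Data.Fin.Properties using (any?; all?; ¬∀⟶∃¬)
open import Data.Fin.Subset using (Subset; inside; outside; _∈_; _∉_; _⊆_; ⊤; ∁; _∪_; _-_; _─_; ⁅_⁆)
open import Data.Fin.Subset.Properties
  using (_∈?_; ∈⊤; x∈⁅x⁆; x∈⁅y⁆⇒x≡y; x∈p∪q⁻; p⊆p∪q; q⊆p∪q; p─q⊆p; x∈p∧x≢y⇒x∈p-y; x∉p⇒x∈∁p)
open import Data.Vec as Vec using (_∷_)
open import Data.Integer using (+_)
open import Data.Rational as ℚ using (ℚ; 0ℚ; 1ℚ; _+_; _*_; -_; _≤_; _<_; _/_; nonNegative)
open import Data.Rational.Properties
  using (≤-refl; ≤-reflexive; ≤-trans; ≤-antisym; <⇒≤; ≤ᵇ⇒≤; +-mono-≤; +-monoʳ-≤; neg-antimono-≤;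
         *-monoˡ-≤-nonNeg; +-identityˡ; +-identityʳ; +-assoc; *-identityʳ; *-zeroʳ; *-1-commutativeMonoid;
         module ≤-Reasoning)
open import Data.Rational.Solver using (module +-*-Solver)
open import Algebra.Bundles using (CommutativeMonoid)
open import Algebra.Properties.CommutativeSemigroup (CommutativeMonoid.commutativeSemigroup *-1-commutativeMonoid)
  using (xy∙z≈xz∙y)
open import Data.List as List using (List; []; _∷_; map; foldr; length)
open import Data.List.Membership.Propositional using () renaming (_∈_ to _∈ₗ_)
open import Data.List.Relation.Unary.Any using (here; there)
open import Data.List.Relation.Unary.All as All using (All; []; _∷_)
open import Data.List.Relation.Unary.All.Properties using (map⁺; ++⁺)
open import Data.List.Relation.Unary.AllPairs using ([]; _∷_)
open import Data.List.Relation.Unary.Unique.Propositional using (Unique)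
open import Data.Unit using (tt) renaming (⊤ to Unit)
open import Data.Empty using (⊥-elim)
open import Data.Sum as Sum using (_⊎_; inj₁; inj₂; [_,_])
open import Data.Product using (Σ; _×_; _,_; proj₁; proj₂; map₁)
open import Function using (id; _∘_)
open import Relation.Nullary using (¬_; yes; no)
open import Relation.Binary.PropositionalEquality
  using (_≡_; _≢_; refl; sym; trans; cong; cong₂; subst; module ≡-Reasoning)
open +-*-Solver

x∈p─q⇒x∉q : ∀ {n} {p q : Subset n} {x} → x ∈ p ─ q → x ∉ q
x∈p─q⇒x∉q {p = inside ∷ _} {outside ∷ _} Vec.here ()
x∈p─q⇒x∉q {p = _ ∷ _} {_ ∷ _} (Vec.there x∈) (Vec.there x∈q) = x∈p─q⇒x∉q x∈ x∈q

module _ {n : ℕ} {p : Subset n} {x y : Fin n} where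

  x∈p-y⇒x∈p : x ∈ p - y → x ∈ p
  x∈p-y⇒x∈p = p─q⊆p _ _

  x∈p-y⇒x≢y : x ∈ p - y → x ≢ y
  x∈p-y⇒x≢y x∈ refl = x∈p─q⇒x∉q x∈ (x∈⁅x⁆ _)

x∈⁅y⁆∪p⁻ : ∀ {n} y (p : Subset n) {x} → x ∈ ⁅ y ⁆ ∪ p → x ≡ y ⊎ x ∈ p
x∈⁅y⁆∪p⁻ y p = Sum.map₁ (x∈⁅y⁆⇒x≡y y) ∘ x∈p∪q⁻ ⁅ y ⁆ p

p⊆q⇒p-x⊆q-x : ∀ {n} {p q : Subset n} {x} → p ⊆ q → p - x ⊆ q - x
p⊆q⇒p-x⊆q-x p⊆q y∈ = x∈p∧x≢y⇒x∈p-y (p⊆q (x∈p-y⇒x∈p y∈)) (x∈p-y⇒x≢y y∈)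

module Walks {n : ℕ} (G : Graph n) where

  vertices : ∀ {W a b} → Walk G W a b → Subset n
  vertices (stay {u} _)     = ⁅ u ⁆
  vertices (step {u} _ _ p) = ⁅ u ⁆ ∪ vertices p

  vertices⊆ : ∀ {W a b} (p : Walk G W a b) → vertices p ⊆ W
  vertices⊆ (stay u∈) y∈ = subst (_∈ _) (sym (x∈⁅y⁆⇒x≡y _ y∈)) u∈
  vertices⊆ (step {u} u∈ _ p) y∈ with x∈⁅y⁆∪p⁻ u (vertices p) y∈
  ... | inj₁ refl = u∈
  ... | inj₂ y∈p  = vertices⊆ p y∈p

  source∈ : ∀ {W a b} (p : Walk G W a b) → a ∈ vertices p
  source∈ (stay _)         = x∈⁅x⁆ _
  source∈ (step {u} _ _ p) = p⊆p∪q (vertices p) (x∈⁅x⁆ u)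

  target∈ : ∀ {W a b} (p : Walk G W a b) → b ∈ vertices p
  target∈ (stay _)         = x∈⁅x⁆ _
  target∈ (step {u} _ _ p) = q⊆p∪q ⁅ u ⁆ (vertices p) (target∈ p)

  restrict : ∀ {W W′ a b} (p : Walk G W a b) → vertices p ⊆ W′ → Walk G W′ a b
  restrict (stay _)          p⊆ = stay (p⊆ (x∈⁅x⁆ _))
  restrict (step {u} _ uv p) p⊆ =
    step (p⊆ (p⊆p∪q (vertices p) (x∈⁅x⁆ u))) uv (restrict p (p⊆ ∘ q⊆p∪q ⁅ u ⁆ (vertices p)))

  weaken : ∀ {W W′ a b} → W ⊆ W′ → Walk G W a b → Walk G W′ a b
  weaken W⊆W′ p = restrict p (W⊆W′ ∘ vertices⊆ p)

  infixr 5 _++_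
  _++_ : ∀ {W a b c} → Walk G W a b → Walk G W b c → Walk G W a c
  stay _       ++ q = q
  step u∈ uv p ++ q = step u∈ uv (p ++ q)

  reverse : ∀ {W a b} → Walk G W a b → Walk G W b a
  reverse (stay a∈) = stay a∈
  reverse (step {u} {v} u∈ uv p) =
    reverse p ++ step (vertices⊆ p (source∈ p)) (trans (adj-sym G v u) uv) (stay u∈)

  IsPath : ∀ {W a b} → Walk G W a b → Set
  IsPath (stay _)         = Unit
  IsPath (step {u} _ _ p) = u ∉ vertices p × IsPath p

  record Splitting {W a b} (p : Walk G W a b) (y : Fin n) : Set where
    field
      prefix  : Walk G W a y
      suffix  : Walk G W y b
      prefix⊆ : vertices prefix ⊆ vertices p
      suffix⊆ : vertices suffix ⊆ vertices p
      path⇒   : IsPath p → IsPath suffix ×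
                (∀ {z} → z ∈ vertices prefix → z ∈ vertices suffix → z ≡ y)
  open Splitting public

  split : ∀ {W a b} (p : Walk G W a b) {y} → y ∈ vertices p → Splitting p y
  split (stay u∈) y∈ with x∈⁅y⁆⇒x≡y _ y∈
  ... | refl = record
    { prefix = stay u∈ ; suffix = stay u∈ ; prefix⊆ = id ; suffix⊆ = id
    ; path⇒ = λ _ → tt , λ z∈ _ → x∈⁅y⁆⇒x≡y _ z∈ }
  split (step {u} u∈ uv p) {y} y∈ with x∈⁅y⁆∪p⁻ u (vertices p) y∈
  ... | inj₁ refl = record
    { prefix = stay u∈ ; suffix = step u∈ uv p ; prefix⊆ = p⊆p∪q (vertices p) ; suffix⊆ = id
    ; path⇒ = λ p-path → p-path , λ z∈ _ → x∈⁅y⁆⇒x≡y _ z∈ }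
  ... | inj₂ y∈p = record
    { prefix  = step u∈ uv (prefix S)
    ; suffix  = suffix S
    ; prefix⊆ = λ z∈ → [ (λ { refl → p⊆p∪q (vertices p) (x∈⁅x⁆ u) })
                         , q⊆p∪q ⁅ u ⁆ (vertices p) ∘ prefix⊆ S
                         ] (x∈⁅y⁆∪p⁻ u (vertices (prefix S)) z∈)
    ; suffix⊆ = q⊆p∪q ⁅ u ⁆ (vertices p) ∘ suffix⊆ S
    ; path⇒   = λ { (u∉p , p-path) → proj₁ (path⇒ S p-path) , λ z∈ z∈suf →
        [ (λ { refl → ⊥-elim (u∉p (suffix⊆ S z∈suf)) })
        , (λ z∈pre → proj₂ (path⇒ S p-path) z∈pre z∈suf)
        ] (x∈⁅y⁆∪p⁻ u (vertices (prefix S)) z∈) } }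
    where
    S : Splitting p y
    S = split p y∈p

  toPath : ∀ {W a b} → Walk G W a b → Σ (Walk G W a b) IsPath
  toPath (stay u∈) = stay u∈ , tt
  toPath (step {u} u∈ uv p) with toPath p
  ... | p′ , p′-path with u ∈? vertices p′
  ...   | yes u∈p′ = suffix (split p′ u∈p′) , proj₁ (path⇒ (split p′ u∈p′) p′-path)
  ...   | no  u∉p′ = step u∈ uv p′ , u∉p′ , p′-path

module Blocks {n : ℕ} (G : Graph n) where
  open Walks G

  edge-blockish : ∀ {u w} → adj G u w ≡ true → Blockish G (⁅ u ⁆ ∪ ⁅ w ⁆)
  edge-blockish {u} {w} uw = ((u , p⊆p∪q ⁅ w ⁆ (x∈⁅x⁆ u)) , λ _ _ a∈ b∈ → edge-walk a∈ b∈ a∈ b∈)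
                           , λ { _ (_ , _ , _ , a∈ , b∈ , ¬walk) →
                                   ¬walk (edge-walk (x∈p-y⇒x∈p a∈) (x∈p-y⇒x∈p b∈) a∈ b∈) }
    where
    end : ∀ {y} → y ∈ ⁅ u ⁆ ∪ ⁅ w ⁆ → y ≡ u ⊎ y ≡ w
    end y∈ = Sum.map₂ (x∈⁅y⁆⇒x≡y w) (x∈⁅y⁆∪p⁻ u ⁅ w ⁆ y∈)

    edge-walk : ∀ {W a b} → a ∈ ⁅ u ⁆ ∪ ⁅ w ⁆ → b ∈ ⁅ u ⁆ ∪ ⁅ w ⁆ → a ∈ W → b ∈ W →
                Walk G W a b
    edge-walk a∈ b∈ a∈W b∈W with end a∈ | end b∈
    ... | inj₁ refl | inj₁ refl = stay a∈W
    ... | inj₁ refl | inj₂ refl = step a∈W uw (stay b∈W)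
    ... | inj₂ refl | inj₁ refl = step a∈W (trans (adj-sym G w u) uw) (stay b∈W)
    ... | inj₂ refl | inj₂ refl = stay a∈W

  -- Having no cut vertex is a negative property, so it only yields walks up to double negation.
  ¬¬walk-avoiding : ∀ {H y h z} → Blockish G H → y ∈ H - z → h ∈ H - z → ¬ ¬ Walk G (H - z) y h
  ¬¬walk-avoiding {H} {y} {h} {z} ((_ , conn) , no-cut) y∈ h∈ ¬walk with z ∈? H
  ... | yes z∈H = no-cut z (z∈H , y , h , y∈ , h∈ , ¬walk)
  ... | no  z∉H = ¬walk (restrict p (λ v∈ → x∈p∧x≢y⇒x∈p-y (vertices⊆ p v∈)
                                               λ { refl → z∉H (vertices⊆ p v∈) }))
    where
    p : Walk G H y h
    p = conn y h (x∈p-y⇒x∈p y∈) (x∈p-y⇒x∈p h∈)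

  ear-blockish : ∀ {H u t w} → Blockish G H → u ∈ H → t ∈ H - u → adj G u w ≡ true →
                 (q : Walk G (⊤ - u) w t) → IsPath q → Blockish G (H ∪ vertices q)
  ear-blockish {H} {u} {t} {w} H-blockish u∈H t∈H-u uw q q-path = connected , λ z → no-cut z
    where
    B : Subset n
    B = H ∪ vertices q
    H⊆B : H ⊆ B
    H⊆B = p⊆p∪q (vertices q)
    q⊆B : vertices q ⊆ B
    q⊆B = q⊆p∪q H (vertices q)
    t∈H : t ∈ H
    t∈H = x∈p-y⇒x∈p t∈H-u
    inside-H : ∀ {a b} → a ∈ H → b ∈ H → Walk G B a b
    inside-H a∈ b∈ = weaken H⊆B (proj₂ (proj₁ H-blockish) _ _ a∈ b∈)

    to-u : ∀ {y} → y ∈ B → Walk G B y u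
    to-u {y} y∈ with x∈p∪q⁻ H (vertices q) y∈
    ... | inj₁ y∈H = inside-H y∈H u∈H
    ... | inj₂ y∈q = restrict (suffix S) (q⊆B ∘ suffix⊆ S) ++ inside-H t∈H u∈H
      where
      S : Splitting q y
      S = split q y∈q

    connected : Connected G B
    connected = (u , H⊆B u∈H) , λ _ _ a∈ b∈ → to-u a∈ ++ reverse (to-u b∈)

    module _ (z : Fin n) where
      hub : Σ (Fin n) λ h → h ∈ H - z
      hub with z ≟ u
      ... | yes refl = t , t∈H-u
      ... | no  z≢u  = u , x∈p∧x≢y⇒x∈p-y u∈H (z≢u ∘ sym)

      inside-H-z : ∀ {a b} → a ∈ H - z → b ∈ H - z → ¬ ¬ Walk G (B - z) a b
      inside-H-z a∈ b∈ k = ¬¬walk-avoiding H-blockish a∈ b∈ (k ∘ weaken (p⊆q⇒p-x⊆q-x H⊆B))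

      -- From y on the ear, the way forward to t avoids z or else the way back to w does,
      -- because the ear is a path.
      along-ear : ∀ {y} → y ∈ vertices q → y ≢ z → ¬ ¬ Walk G (B - z) y (proj₁ hub)
      along-ear {y} y∈q y≢z = via (split q y∈q)
        where
        via : Splitting q y → ¬ ¬ Walk G (B - z) y (proj₁ hub)
        via S with z ∈? vertices (suffix S)
        ... | no z∉suf = λ k → inside-H-z (x∈p∧x≢y⇒x∈p-y t∈H t≢z) (proj₂ hub) (k ∘ (forward ++_))
          where
          avoid : vertices (suffix S) ⊆ B - z
          avoid v∈ = x∈p∧x≢y⇒x∈p-y (q⊆B (suffix⊆ S v∈)) λ { refl → z∉suf v∈ }
          t≢z : t ≢ z
          t≢z refl = z∉suf (target∈ (suffix S))
          forward : Walk G (B - z) y t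
          forward = restrict (suffix S) avoid
        ... | yes z∈suf =
          λ k → inside-H-z (x∈p∧x≢y⇒x∈p-y u∈H (z≢u ∘ sym)) (proj₂ hub) (k ∘ (backward ++_))
          where
          z≢u : z ≢ u
          z≢u = x∈p-y⇒x≢y (vertices⊆ q (suffix⊆ S z∈suf))
          avoid : vertices (prefix S) ⊆ B - z
          avoid v∈ = x∈p∧x≢y⇒x∈p-y (q⊆B (prefix⊆ S v∈))
                       λ { refl → y≢z (sym (proj₂ (path⇒ S q-path) v∈ z∈suf)) }
          backward : Walk G (B - z) y u
          backward = reverse (restrict (prefix S) avoid)
                     ++ step (avoid (source∈ (prefix S))) (trans (adj-sym G w u) uw)
                          (stay (x∈p∧x≢y⇒x∈p-y (H⊆B u∈H) (z≢u ∘ sym)))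

      to-hub : ∀ {y} → y ∈ B - z → ¬ ¬ Walk G (B - z) y (proj₁ hub)
      to-hub y∈ with x∈p∪q⁻ H (vertices q) (x∈p-y⇒x∈p y∈)
      ... | inj₁ y∈H = inside-H-z (x∈p∧x≢y⇒x∈p-y y∈H (x∈p-y⇒x≢y y∈)) (proj₂ hub)
      ... | inj₂ y∈q = along-ear y∈q (x∈p-y⇒x≢y y∈)

      no-cut : ¬ CutVertexOf G B z
      no-cut (_ , _ , _ , a∈ , b∈ , ¬walk) = to-hub a∈ λ wa → to-hub b∈ λ wb → ¬walk (wa ++ reverse wb)

  module _ {H} (H-block : Block G H) {u w} (u∈H : u ∈ H) (w∉H : w ∉ H) (uw : adj G u w ≡ true) where

    private
      ⊇H⇒≡H : ∀ {B} → H ⊆ B → Blockish G B → B ≡ H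
      ⊇H⇒≡H H⊆B B-blockish = proj₂ H-block _ H⊆B B-blockish

    ¬¬second-vertex : ¬ ¬ (Σ (Fin n) λ t → t ∈ H - u)
    ¬¬second-vertex none =
      w∉H (subst (w ∈_) (⊇H⇒≡H H⊆uw (edge-blockish uw)) (q⊆p∪q ⁅ u ⁆ ⁅ w ⁆ (x∈⁅x⁆ w)))
      where
      H⊆uw : H ⊆ ⁅ u ⁆ ∪ ⁅ w ⁆
      H⊆uw {y} y∈ with y ≟ u
      ... | yes refl = p⊆p∪q ⁅ w ⁆ (x∈⁅x⁆ u)
      ... | no  y≢u  = ⊥-elim (none (y , x∈p∧x≢y⇒x∈p-y y∈ y≢u))

    ¬¬cut-vertex : ¬ ¬ CutVertexOf G ⊤ u
    ¬¬cut-vertex not-cut = ¬¬second-vertex λ (t , t∈H-u) →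
      not-cut (∈⊤ , w , t , ∈⊤-u (λ { refl → w∉H u∈H }) , ∈⊤-u (x∈p-y⇒x≢y t∈H-u) ,
               λ p → let (q , q-path) = toPath p in
                 w∉H (subst (w ∈_)
                            (⊇H⇒≡H (p⊆p∪q (vertices q)) (ear-blockish (proj₁ H-block) u∈H t∈H-u uw q q-path))
                            (q⊆p∪q H (vertices q) (source∈ q))))
      where
      ∈⊤-u : ∀ {y} → y ≢ u → y ∈ ⊤ - u
      ∈⊤-u = x∈p∧x≢y⇒x∈p-y ∈⊤

  leaving-edge : ∀ {W a b H} → Walk G W a b → a ∈ H → b ∉ H →
                 Σ (Fin n) λ u → Σ (Fin n) λ w → u ∈ H × w ∉ H × adj G u w ≡ true
  leaving-edge (stay _) a∈ b∉ = ⊥-elim (b∉ a∈)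
  leaving-edge {H = H} (step {u} {v} _ uv p) u∈ b∉ with v ∈? H
  ... | yes v∈ = leaving-edge p v∈ b∉
  ... | no  v∉ = u , v , u∈ , v∉ , uv

  record Attachment (H : Subset n) : Set where
    field
      point    : Fin n
      point∈   : point ∈ H
      other    : Fin n
      other∈   : other ∈ H - point
      boundary : ∀ {u w} → u ∈ H → w ∉ H → adj G u w ≡ true → u ≡ point

  terminal-block-attachment : ∀ {H} → Connected G ⊤ → TerminalBlock G H → (∀ y → y ∈ H) ⊎ Attachment H
  terminal-block-attachment {H} (_ , G-conn) (H-block , terminal) with all? (_∈? H)
  ... | yes H-full = inj₁ H-full
  ... | no  H-partial with ¬∀⟶∃¬ n _ (_∈? H) H-partial | proj₁ (proj₁ (proj₁ H-block))
  ...   | y , y∉H | h , h∈H with leaving-edge (G-conn h y ∈⊤ ∈⊤) h∈H y∉H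
  ...     | x , w , x∈H , w∉H , xw = inj₂ record
    { point = x ; point∈ = x∈H ; other = proj₁ second ; other∈ = proj₂ second ; boundary = boundary }
    where
    second : Σ (Fin n) λ t → t ∈ H - x
    second with any? (λ t → t ∈? H - x)
    ... | yes t∈ = t∈
    ... | no  ∄t = ⊥-elim (¬¬second-vertex H-block x∈H w∉H xw ∄t)

    -- x and u are both cut vertices of G lying in the terminal block H
    boundary : ∀ {u w′} → u ∈ H → w′ ∉ H → adj G u w′ ≡ true → u ≡ x
    boundary {u} u∈H w′∉H uw′ with u ≟ x
    ... | yes u≡x = u≡x
    ... | no  u≢x = ⊥-elim (¬¬cut-vertex H-block u∈H w′∉H uw′ λ u-cut →
                             ¬¬cut-vertex H-block x∈H w∉H xw λ x-cut → u≢x (terminal u x u∈H x∈H u-cut x-cut))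

open Blocks using (Attachment; terminal-block-attachment)

𝟙 : Bool → ℚ
𝟙 true  = 1ℚ
𝟙 false = 0ℚ

0≤𝟙 : ∀ b → 0ℚ ≤ 𝟙 b
0≤𝟙 true  = ≤ᵇ⇒≤ _
0≤𝟙 false = ≤-refl

𝟙-not : ∀ b → 𝟙 (not b) + 𝟙 b ≡ 1ℚ
𝟙-not true  = refl
𝟙-not false = refl

≡ᵇ-refl : ∀ m → (m ≡ᵇ m) ≡ true
≡ᵇ-refl zero    = refl
≡ᵇ-refl (suc m) = ≡ᵇ-refl m

≡ᵇ-sym : ∀ m k → (m ≡ᵇ k) ≡ (k ≡ᵇ m)
≡ᵇ-sym zero    zero    = refl
≡ᵇ-sym zero    (suc k) = refl
≡ᵇ-sym (suc m) zero    = refl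
≡ᵇ-sym (suc m) (suc k) = ≡ᵇ-sym m k

≡ᵇ-true⇒≡ : ∀ {m k} → (m ≡ᵇ k) ≡ true → m ≡ k
≡ᵇ-true⇒≡ {m} {k} eq = ≡ᵇ⇒≡ m k (subst T (sym eq) _)

≢⇒≡ᵇ-false : ∀ {m k} → m ≢ k → (m ≡ᵇ k) ≡ false
≢⇒≡ᵇ-false {m} {k} m≢k with m ≡ᵇ k in eq
... | true  = ⊥-elim (m≢k (≡ᵇ-true⇒≡ eq))
... | false = refl

*-monoˡ-≤-≥0 : ∀ {p q} r → 0ℚ ≤ r → p ≤ q → r * p ≤ r * q
*-monoˡ-≤-≥0 r 0≤r = *-monoˡ-≤-nonNeg r {{nonNegative 0≤r}}

0≤* : ∀ {p q} → 0ℚ ≤ p → 0ℚ ≤ q → 0ℚ ≤ p * q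
0≤* {p} {q} 0≤p 0≤q = subst (_≤ p * q) (*-zeroʳ p) (*-monoˡ-≤-≥0 p 0≤p 0≤q)

p≤r-q⇒q≤r-p : ∀ {p q r} → p ≤ r ℚ.- q → q ≤ r ℚ.- p
p≤r-q⇒q≤r-p {p} {q} {r} p≤r-q = subst (_≤ r ℚ.- p) (solve 2 (λ q r → r :+ (:- (r :- q)) := q) refl q r)
                                         (+-monoʳ-≤ r (neg-antimono-≤ p≤r-q))

module _ {A : Set} where

  𝔼 : List (ℚ × A) → (A → ℚ) → ℚ
  𝔼 []            f = 0ℚ
  𝔼 ((w , a) ∷ l) f = w * f a + 𝔼 l f

  𝔼-cong : ∀ l {f g : A → ℚ} → (∀ a → f a ≡ g a) → 𝔼 l f ≡ 𝔼 l g
  𝔼-cong []            f≡g = refl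
  𝔼-cong ((w , a) ∷ l) f≡g = cong₂ (λ x y → w * x + y) (f≡g a) (𝔼-cong l f≡g)

  𝔼-congᴬ : ∀ {P : A → Set} {l f g} → All (P ∘ proj₂) l → (∀ a → P a → f a ≡ g a) →
            𝔼 l f ≡ 𝔼 l g
  𝔼-congᴬ {l = []}          []        f≡g = refl
  𝔼-congᴬ {l = (w , a) ∷ l} (pa ∷ ps) f≡g = cong₂ (λ x y → w * x + y) (f≡g a pa) (𝔼-congᴬ ps f≡g)

  𝔼-monoᴬ : ∀ {P : A → Set} {l f g} → All ((0ℚ ≤_) ∘ proj₁) l → All (P ∘ proj₂) l →
            (∀ a → P a → f a ≤ g a) → 𝔼 l f ≤ 𝔼 l g
  𝔼-monoᴬ []         []        f≤g = ≤-refl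
  𝔼-monoᴬ (0≤w ∷ ws) (pa ∷ ps) f≤g =
    +-mono-≤ (*-monoˡ-≤-≥0 _ 0≤w (f≤g _ pa)) (𝔼-monoᴬ ws ps f≤g)

  𝔼-zero : ∀ l → 𝔼 l (λ _ → 0ℚ) ≡ 0ℚ
  𝔼-zero []            = refl
  𝔼-zero ((w , _) ∷ l) = cong₂ _+_ (*-zeroʳ w) (𝔼-zero l)

  𝔼-+ : ∀ l f g → 𝔼 l (λ a → f a + g a) ≡ 𝔼 l f + 𝔼 l g
  𝔼-+ []            f g = sym (+-identityʳ 0ℚ)
  𝔼-+ ((w , a) ∷ l) f g rewrite 𝔼-+ l f g =
    solve 5 (λ w x y u v → w :* (x :+ y) :+ (u :+ v) := (w :* x :+ u) :+ (w :* y :+ v)) refl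
      w (f a) (g a) (𝔼 l f) (𝔼 l g)

  𝔼-*ˡ : ∀ l k f → 𝔼 l (λ a → k * f a) ≡ k * 𝔼 l f
  𝔼-*ˡ []            k f = sym (*-zeroʳ k)
  𝔼-*ˡ ((w , a) ∷ l) k f rewrite 𝔼-*ˡ l k f =
    solve 4 (λ w k x u → w :* (k :* x) :+ k :* u := k :* (w :* x :+ u)) refl w k (f a) (𝔼 l f)

  𝔼-++ : ∀ l m f → 𝔼 (l List.++ m) f ≡ 𝔼 l f + 𝔼 m f
  𝔼-++ []            m f = sym (+-identityˡ _)
  𝔼-++ ((w , a) ∷ l) m f rewrite 𝔼-++ l m f = sym (+-assoc (w * f a) (𝔼 l f) (𝔼 m f))

  𝔼-one≡sum : ∀ l → 𝔼 l (λ _ → 1ℚ) ≡ foldr (λ p s → proj₁ p + s) 0ℚ l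
  𝔼-one≡sum []            = refl
  𝔼-one≡sum ((w , _) ∷ l) = cong₂ _+_ (*-identityʳ w) (𝔼-one≡sum l)

module _ {A B : Set} where

  𝔼-swap : ∀ (l : List (ℚ × A)) (m : List (ℚ × B)) (h : A → B → ℚ) →
           𝔼 l (λ a → 𝔼 m (h a)) ≡ 𝔼 m (λ b → 𝔼 l (λ a → h a b))
  𝔼-swap []            m h = sym (𝔼-zero m)
  𝔼-swap ((w , a) ∷ l) m h = begin
    w * 𝔼 m (h a) + 𝔼 l (λ a′ → 𝔼 m (h a′))
      ≡⟨ cong₂ _+_ (sym (𝔼-*ˡ m w (h a))) (𝔼-swap l m h) ⟩
    𝔼 m (λ b → w * h a b) + 𝔼 m (λ b → 𝔼 l (λ a′ → h a′ b))
      ≡⟨ sym (𝔼-+ m _ _) ⟩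
    𝔼 m (λ b → w * h a b + 𝔼 l (λ a′ → h a′ b)) ∎
    where open ≡-Reasoning

  bind : List (ℚ × A) → (A → List (ℚ × B)) → List (ℚ × B)
  bind []            k = []
  bind ((w , a) ∷ l) k = map (map₁ (w *_)) (k a) List.++ bind l k

  𝔼-bind : ∀ l k f → 𝔼 (bind l k) f ≡ 𝔼 l (λ a → 𝔼 (k a) f)
  𝔼-bind []            k f = refl
  𝔼-bind ((w , a) ∷ l) k f =
    trans (𝔼-++ (map (map₁ (w *_)) (k a)) (bind l k) f) (cong₂ _+_ (𝔼-scale (k a)) (𝔼-bind l k f))
    where
    𝔼-scale : ∀ m → 𝔼 (map (map₁ (w *_)) m) f ≡ w * 𝔼 m f
    𝔼-scale []            = sym (*-zeroʳ w)
    𝔼-scale ((v , b) ∷ m) rewrite 𝔼-scale m =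
      solve 4 (λ w v x u → w :* v :* x :+ w :* u := w :* (v :* x :+ u)) refl w v (f b) (𝔼 m f)

  select : ℚ → (A → Bool) → (A → B) → List (ℚ × A) → List (ℚ × B)
  select k test m []            = []
  select k test m ((w , a) ∷ l) = if test a then (k * w , m a) ∷ select k test m l else select k test m l

  𝔼-select : ∀ k test m l f → 𝔼 (select k test m l) f ≡ 𝔼 l (λ a → k * 𝟙 (test a) * f (m a))
  𝔼-select k test m []            f = refl
  𝔼-select k test m ((w , a) ∷ l) f with test a
  ... | true  = cong₂ _+_ (solve 3 (λ k w x → k :* w :* x := w :* (k :* con 1ℚ :* x)) refl k w (f (m a)))
                          (𝔼-select k test m l f)
  ... | false = trans (𝔼-select k test m l f) (sym (trans (cong (_+ _) w*[k*0*y]≡0) (+-identityˡ _)))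
    where
    w*[k*0*y]≡0 : w * (k * 0ℚ * f (m a)) ≡ 0ℚ
    w*[k*0*y]≡0 = solve 3 (λ k w y → w :* (k :* con 0ℚ :* y) := con 0ℚ) refl k w (f (m a))

  bind-nonneg : ∀ {l : List (ℚ × A)} {k : A → List (ℚ × B)} → All ((0ℚ ≤_) ∘ proj₁) l →
                (∀ a → All ((0ℚ ≤_) ∘ proj₁) (k a)) → All ((0ℚ ≤_) ∘ proj₁) (bind l k)
  bind-nonneg {(w , a) ∷ l} (0≤w ∷ ws) k≥0 = ++⁺ (map⁺ (scaled (k≥0 a))) (bind-nonneg ws k≥0)
    where
    scaled : ∀ {m} → All ((0ℚ ≤_) ∘ proj₁) m → All ((0ℚ ≤_) ∘ proj₁ ∘ map₁ (w *_)) m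
    scaled = All.map (0≤* 0≤w)
  bind-nonneg {[]} [] k≥0 = []

  bind-values : ∀ {P : A → Set} {Q : B → Set} {l k} → All (P ∘ proj₂) l →
                (∀ a → P a → All (Q ∘ proj₂) (k a)) → All (Q ∘ proj₂) (bind l k)
  bind-values {l = []}          []        kQ = []
  bind-values {l = (w , a) ∷ l} (pa ∷ ps) kQ = ++⁺ (map⁺ (kQ a pa)) (bind-values ps kQ)

  select-nonneg : ∀ {k test m} {l : List (ℚ × A)} → 0ℚ ≤ k → All ((0ℚ ≤_) ∘ proj₁) l →
                  All ((0ℚ ≤_) ∘ proj₁) (select k test m l)
  select-nonneg {test = test} {l = (w , a) ∷ l} 0≤k (0≤w ∷ ws) with test a
  ... | true  = 0≤* 0≤k 0≤w ∷ select-nonneg 0≤k ws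
  ... | false = select-nonneg 0≤k ws
  select-nonneg {l = []} 0≤k [] = []

  select-values : ∀ {P : A → Set} {Q : B → Set} {k test m l} → All (P ∘ proj₂) l →
                  (∀ a → P a → test a ≡ true → Q (m a)) → All (Q ∘ proj₂) (select k test m l)
  select-values {l = []} [] mQ = []
  select-values {test = test} {l = (w , a) ∷ l} (pa ∷ ps) mQ with test a in passes
  ... | true  = mQ a pa passes ∷ select-values ps mQ
  ... | false = select-values ps mQ

𝟙-partition : ∀ {a b d k} → a ≢ b → a ≢ d → b ≢ d → k ∈ₗ a ∷ b ∷ d ∷ [] →
              𝟙 (k ≡ᵇ a) + 𝟙 (k ≡ᵇ b) + 𝟙 (k ≡ᵇ d) ≡ 1ℚ
𝟙-partition {a} a≢b a≢d b≢d (here refl)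
  rewrite ≡ᵇ-refl a | ≢⇒≡ᵇ-false a≢b | ≢⇒≡ᵇ-false a≢d = refl
𝟙-partition {b = b} a≢b a≢d b≢d (there (here refl))
  rewrite ≡ᵇ-refl b | ≢⇒≡ᵇ-false (a≢b ∘ sym) | ≢⇒≡ᵇ-false b≢d = refl
𝟙-partition {d = d} a≢b a≢d b≢d (there (there (here refl)))
  rewrite ≡ᵇ-refl d | ≢⇒≡ᵇ-false (a≢d ∘ sym) | ≢⇒≡ᵇ-false (b≢d ∘ sym) = refl

x+y+z≡1⇒x≤⅓ : ∀ {x y z} → x + y + z ≡ 1ℚ → oneThird ≤ y → oneThird ≤ z → x ≤ oneThird
x+y+z≡1⇒x≤⅓ {x} {y} {z} sum ⅓≤y ⅓≤z =
  subst (_≤ oneThird) x≡ (+-mono-≤ (+-monoʳ-≤ 1ℚ (neg-antimono-≤ ⅓≤y)) (neg-antimono-≤ ⅓≤z))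
  where
  x≡ : 1ℚ ℚ.- y ℚ.- z ≡ x
  x≡ = trans (cong (λ s → s ℚ.- y ℚ.- z) (sym sum))
             (solve 3 (λ x y z → x :+ y :+ z :- y :- z := x) refl x y z)

module _ {n : ℕ} (G : Graph n) {W : Subset n} {L : ListAssignment G} (D : Distribution G W L) where

  Pr≡𝔼 : ∀ E → Pr G D E ≡ 𝔼 (support D) (𝟙 ∘ E)
  Pr≡𝔼 E = go (support D)
    where
    go : ∀ l → foldr (λ p s → (if E (proj₂ p) then proj₁ p else 0ℚ) + s) 0ℚ l ≡ 𝔼 l (𝟙 ∘ E)
    go [] = refl
    go ((w , φ) ∷ l) with E φ
    ... | true  = cong₂ _+_ (sym (*-identityʳ w)) (go l)
    ... | false = cong₂ _+_ (sym (*-zeroʳ w)) (go l)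

  𝔼-one : 𝔼 (support D) (λ _ → 1ℚ) ≡ 1ℚ
  𝔼-one = trans (𝔼-one≡sum (support D)) (total D)

  Pr-not : ∀ E → Pr G D (not ∘ E) ≡ 1ℚ ℚ.- Pr G D E
  Pr-not E = begin
    Pr G D (not ∘ E)                                  ≡⟨ Pr≡𝔼 (not ∘ E) ⟩
    𝔼 (support D) (𝟙 ∘ not ∘ E)                       ≡⟨ solve 2 (λ p q → p := p :+ q :- q) refl _ _ ⟩
    𝔼 (support D) (𝟙 ∘ not ∘ E) + 𝔼 (support D) (𝟙 ∘ E) ℚ.- 𝔼 (support D) (𝟙 ∘ E)
      ≡⟨ cong₂ ℚ._-_ (trans (sym (𝔼-+ (support D) _ _)) (trans (𝔼-cong (support D) (𝟙-not ∘ E)) 𝔼-one))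
                     (sym (Pr≡𝔼 E)) ⟩
    1ℚ ℚ.- Pr G D E                                     ∎
    where open ≡-Reasoning

  Pr≤1-α⇒α≤Pr-not : ∀ {α} E → Pr G D E ≤ 1ℚ ℚ.- α → α ≤ Pr G D (not ∘ E)
  Pr≤1-α⇒α≤Pr-not E Pr≤ = subst (_ ≤_) (sym (Pr-not E)) (p≤r-q⇒q≤r-p {r = 1ℚ} Pr≤)

  α≤Pr-not⇒Pr≤1-α : ∀ {α} E → α ≤ Pr G D (not ∘ E) → Pr G D E ≤ 1ℚ ℚ.- α
  α≤Pr-not⇒Pr≤1-α E α≤ = p≤r-q⇒q≤r-p {r = 1ℚ} (subst (_ ≤_) (Pr-not E) α≤)

  module _ {v} (v∈W : v ∈ W) (L-3 : Unique (L v) × length (L v) ≡ 3)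
           (fix : ∀ c → c ∈ₗ L v → oneThird ≤ Pr G D (evEq G v c)) where

    Pr-colour≤⅓ : ∀ c → Pr G D (evEq G v c) ≤ oneThird
    Pr-colour≤⅓ = go (L v) (proj₁ L-3) (proj₂ L-3) (All.map (λ φ-col → proj₁ φ-col v v∈W) (colouring D))
                     fix
      where
      P : ℕ → ℚ
      P c = Pr G D (evEq G v c)
      go : ∀ cs → Unique cs → length cs ≡ 3 → All (λ p → proj₂ p v ∈ₗ cs) (support D) →
           (∀ c → c ∈ₗ cs → oneThird ≤ P c) → ∀ c → P c ≤ oneThird
      go (a ∷ b ∷ d ∷ []) ((a≢b ∷ a≢d ∷ []) ∷ (b≢d ∷ []) ∷ [] ∷ []) refl in-cs ⅓≤ = bound
        where
        ⅓≤a : oneThird ≤ P a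
        ⅓≤a = ⅓≤ a (here refl)
        ⅓≤b : oneThird ≤ P b
        ⅓≤b = ⅓≤ b (there (here refl))
        ⅓≤d : oneThird ≤ P d
        ⅓≤d = ⅓≤ d (there (there (here refl)))

        sum : P a + P b + P d ≡ 1ℚ
        sum = begin
          P a + P b + P d
            ≡⟨ cong₂ _+_ (cong₂ _+_ (Pr≡𝔼 (evEq G v a)) (Pr≡𝔼 (evEq G v b))) (Pr≡𝔼 (evEq G v d)) ⟩
          𝔼 l (𝟙 ∘ evEq G v a) + 𝔼 l (𝟙 ∘ evEq G v b) + 𝔼 l (𝟙 ∘ evEq G v d)
            ≡⟨ trans (cong (_+ _) (sym (𝔼-+ l _ _))) (sym (𝔼-+ l _ _)) ⟩
          𝔼 l (λ φ → 𝟙 (φ v ≡ᵇ a) + 𝟙 (φ v ≡ᵇ b) + 𝟙 (φ v ≡ᵇ d))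
            ≡⟨ 𝔼-congᴬ in-cs (λ φ → 𝟙-partition a≢b a≢d b≢d) ⟩
          𝔼 l (λ _ → 1ℚ)
            ≡⟨ 𝔼-one ⟩
          1ℚ ∎
          where
          l : List (ℚ × (Fin n → ℕ))
          l = support D
          open ≡-Reasoning

        bound : ∀ c → P c ≤ oneThird
        bound c with c ℕ.≟ a | c ℕ.≟ b | c ℕ.≟ d
        ... | yes refl | _ | _ = x+y+z≡1⇒x≤⅓ sum ⅓≤b ⅓≤d
        ... | _ | yes refl | _ =
          x+y+z≡1⇒x≤⅓ (trans (solve 3 (λ x y z → y :+ x :+ z := x :+ y :+ z) refl (P a) (P b) (P d)) sum)
                      ⅓≤a ⅓≤d
        ... | _ | _ | yes refl =
          x+y+z≡1⇒x≤⅓ (trans (solve 3 (λ x y z → z :+ x :+ y := x :+ y :+ z) refl (P a) (P b) (P d)) sum)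
                      ⅓≤a ⅓≤b
        ... | no c≢a | no c≢b | no c≢d = ≤-trans (≤-reflexive P≡0) (≤ᵇ⇒≤ _)
          where
          ≢c : ∀ {k} → k ∈ₗ a ∷ b ∷ d ∷ [] → k ≢ c
          ≢c (here refl)                 = c≢a ∘ sym
          ≢c (there (here refl))         = c≢b ∘ sym
          ≢c (there (there (here refl))) = c≢d ∘ sym
          P≡0 : P c ≡ 0ℚ
          P≡0 = trans (Pr≡𝔼 (evEq G v c))
                      (trans (𝔼-congᴬ in-cs (λ φ k∈ → cong 𝟙 (≢⇒≡ᵇ-false (≢c k∈))))
                             (𝔼-zero (support D)))

    Pr-colour≡⅓ : ∀ c → c ∈ₗ L v → Pr G D (evEq G v c) ≡ oneThird
    Pr-colour≡⅓ c c∈ = ≤-antisym (Pr-colour≤⅓ c) (fix c c∈)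

three : ℚ
three = + 3 / 1

0≤three : 0ℚ ≤ three
0≤three = ≤ᵇ⇒≤ _

three*p*⅓≡p : ∀ p → three * p * oneThird ≡ p
three*p*⅓≡p = solve 1 (λ p → con three :* p :* con oneThird := p) refl

module Gluing {n : ℕ} (G : Graph n) {H : Subset n} (att : Attachment G H)
              {L : ListAssignment G} (L-3 : IsAssignment G ⊤ (λ _ → 3) L)
              (DH : Distribution G H L) (fixH : ∀ v c → v ∈ H → c ∈ₗ L v → oneThird ≤ Pr G DH (evEq G v c))
              (DA : Distribution G (∁ (H - Attachment.point att)) L) where

  open Attachment att renaming (point to x; point∈ to x∈H)

  S : Subset n
  S = H - x

  x∈∁S : x ∈ ∁ S
  x∈∁S = x∉p⇒x∈∁p λ x∈S → x∈p-y⇒x≢y x∈S refl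

  Colouring : Set
  Colouring = Fin n → ℕ

  merge : Colouring → Colouring → Colouring
  merge ψ φ y with y ∈? S
  ... | yes _ = φ y
  ... | no  _ = ψ y

  merge-∈ : ∀ ψ φ {y} → y ∈ S → merge ψ φ y ≡ φ y
  merge-∈ ψ φ {y} y∈S with y ∈? S
  ... | yes _   = refl
  ... | no  y∉S = ⊥-elim (y∉S y∈S)

  merge-∉ : ∀ ψ φ {y} → y ∉ S → merge ψ φ y ≡ ψ y
  merge-∉ ψ φ {y} y∉S with y ∈? S
  ... | yes y∈S = ⊥-elim (y∉S y∈S)
  ... | no  _   = refl

  merge-colouring : ∀ {ψ φ} → IsLColouring G (∁ S) L ψ → IsLColouring G H L φ → ψ x ≡ φ x →
                    IsLColouring G ⊤ L (merge ψ φ)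
  merge-colouring {ψ} {φ} (ψ∈L , ψ-proper) (φ∈L , φ-proper) ψx≡φx = ∈L , proper
    where
    ∈L : ∀ y → y ∈ ⊤ → merge ψ φ y ∈ₗ L y
    ∈L y _ with y ∈? S
    ... | yes y∈S = φ∈L y (x∈p-y⇒x∈p y∈S)
    ... | no  y∉S = ψ∈L y (x∉p⇒x∈∁p y∉S)
    -- the only edges between S and its complement end in x
    across : ∀ {u v} → u ∈ S → v ∉ S → adj G u v ≡ true → φ u ≢ ψ v
    across {u} {v} u∈S v∉S uv with v ≟ x | v ∈? H
    ... | yes refl | _     = λ eq → φ-proper u x (x∈p-y⇒x∈p u∈S) x∈H uv (trans eq ψx≡φx)
    ... | no  v≢x | yes v∈H = ⊥-elim (v∉S (x∈p∧x≢y⇒x∈p-y v∈H v≢x))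
    ... | no  _   | no  v∉H = ⊥-elim (x∈p-y⇒x≢y u∈S (boundary (x∈p-y⇒x∈p u∈S) v∉H uv))
    proper : ∀ u v → u ∈ ⊤ → v ∈ ⊤ → adj G u v ≡ true → merge ψ φ u ≢ merge ψ φ v
    proper u v _ _ uv with u ∈? S | v ∈? S
    ... | yes u∈S | yes v∈S = φ-proper u v (x∈p-y⇒x∈p u∈S) (x∈p-y⇒x∈p v∈S) uv
    ... | no  u∉S | no  v∉S = ψ-proper u v (x∉p⇒x∈∁p u∉S) (x∉p⇒x∈∁p v∉S) uv
    ... | yes u∈S | no  v∉S = across u∈S v∉S uv
    ... | no  u∉S | yes v∈S = λ eq → across v∈S u∉S (trans (adj-sym G v u) uv) (sym eq)

  L-3′ : ∀ v → Unique (L v) × length (L v) ≡ 3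
  L-3′ v = L-3 v ∈⊤

  -- DH conditioned on φ x = ψ x: the weight three is 1 / Pr(φ x = ψ x)
  kernel : Colouring → List (ℚ × Colouring)
  kernel ψ = select three (λ φ → ψ x ≡ᵇ φ x) (merge ψ) (support DH)

  𝔼-glued : ∀ f → 𝔼 (bind (support DA) kernel) f ≡
            𝔼 (support DA) (λ ψ → 𝔼 (support DH) (λ φ → three * 𝟙 (ψ x ≡ᵇ φ x) * f (merge ψ φ)))
  𝔼-glued f = trans (𝔼-bind (support DA) kernel f)
                    (𝔼-cong (support DA) λ ψ → 𝔼-select three _ (merge ψ) (support DH) f)

  𝔼-glued-outer : ∀ f F → (∀ ψ φ → f (merge ψ φ) ≡ F ψ) →
                  𝔼 (bind (support DA) kernel) f ≡ 𝔼 (support DA) F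
  𝔼-glued-outer f F f≡F = trans (𝔼-glued f) (𝔼-congᴬ (colouring DA) λ ψ ψ-col → begin
      𝔼 (support DH) (λ φ → three * 𝟙 (ψ x ≡ᵇ φ x) * f (merge ψ φ))
    ≡⟨ 𝔼-cong (support DH) (λ φ → trans (cong₂ (λ i y → three * i * y)
                                               (cong 𝟙 (≡ᵇ-sym (ψ x) (φ x))) (f≡F ψ φ))
                                        (xy∙z≈xz∙y three _ (F ψ))) ⟩
      𝔼 (support DH) (λ φ → three * F ψ * 𝟙 (φ x ≡ᵇ ψ x))
    ≡⟨ 𝔼-*ˡ (support DH) (three * F ψ) _ ⟩
      three * F ψ * 𝔼 (support DH) (𝟙 ∘ evEq G x (ψ x))
    ≡⟨ cong (three * F ψ *_) (trans (sym (Pr≡𝔼 G DH (evEq G x (ψ x))))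
             (Pr-colour≡⅓ G DH x∈H (L-3′ x) (λ c → fixH x c x∈H) (ψ x) (proj₁ ψ-col x x∈∁S))) ⟩
      three * F ψ * oneThird
    ≡⟨ three*p*⅓≡p (F ψ) ⟩
      F ψ ∎)
    where open ≡-Reasoning

  glued : Distribution G ⊤ L
  glued = record
    { support   = bind (support DA) kernel
    ; nonneg    = bind-nonneg (nonneg DA) (λ _ → select-nonneg 0≤three (nonneg DH))
    ; total     = trans (sym (𝔼-one≡sum (bind (support DA) kernel)))
                        (trans (𝔼-glued-outer (λ _ → 1ℚ) (λ _ → 1ℚ) (λ _ _ → refl)) (𝔼-one G DA))
    ; colouring = bind-values (colouring DA) λ _ ψ-col →
                    select-values (colouring DH) λ _ φ-col agree →
                      merge-colouring ψ-col φ-col (≡ᵇ-true⇒≡ agree)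
    }

  Pr-glued-∉ : ∀ {v} → v ∉ S → (E : ℕ → Bool) →
               Pr G glued (λ χ → E (χ v)) ≡ Pr G DA (λ χ → E (χ v))
  Pr-glued-∉ {v} v∉S E = trans (Pr≡𝔼 G glued (λ χ → E (χ v)))
    (trans (𝔼-glued-outer _ _ (λ ψ φ → cong (𝟙 ∘ E) (merge-∉ ψ φ v∉S)))
           (sym (Pr≡𝔼 G DA (λ χ → E (χ v)))))

  Pr-glued-∈ : ∀ {v} → v ∈ S → ∀ c → Pr G glued (evEq G v c) ≡
               𝔼 (support DH) (λ φ → three * 𝟙 (φ v ≡ᵇ c) * Pr G DA (evEq G x (φ x)))
  Pr-glued-∈ {v} v∈S c = begin
      Pr G glued (evEq G v c)
    ≡⟨ trans (Pr≡𝔼 G glued (evEq G v c)) (𝔼-glued (λ χ → 𝟙 (χ v ≡ᵇ c))) ⟩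
      𝔼 (support DA) (λ ψ → 𝔼 (support DH) (λ φ → three * 𝟙 (ψ x ≡ᵇ φ x) * 𝟙 (merge ψ φ v ≡ᵇ c)))
    ≡⟨ 𝔼-swap (support DA) (support DH) _ ⟩
      𝔼 (support DH) (λ φ → 𝔼 (support DA) (λ ψ → three * 𝟙 (ψ x ≡ᵇ φ x) * 𝟙 (merge ψ φ v ≡ᵇ c)))
    ≡⟨ 𝔼-cong (support DH) inner ⟩
      𝔼 (support DH) (λ φ → three * 𝟙 (φ v ≡ᵇ c) * Pr G DA (evEq G x (φ x))) ∎
    where
    open ≡-Reasoning
    inner : ∀ φ → 𝔼 (support DA) (λ ψ → three * 𝟙 (ψ x ≡ᵇ φ x) * 𝟙 (merge ψ φ v ≡ᵇ c)) ≡
                  three * 𝟙 (φ v ≡ᵇ c) * Pr G DA (evEq G x (φ x))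
    inner φ = trans (𝔼-cong (support DA) (λ ψ →
                      trans (cong (λ k → three * 𝟙 (ψ x ≡ᵇ φ x) * 𝟙 (k ≡ᵇ c)) (merge-∈ ψ φ v∈S))
                            (xy∙z≈xz∙y three (𝟙 (ψ x ≡ᵇ φ x)) (𝟙 (φ v ≡ᵇ c)))))
                    (trans (𝔼-*ˡ (support DA) (three * 𝟙 (φ v ≡ᵇ c)) (λ ψ → 𝟙 (ψ x ≡ᵇ φ x)))
                           (cong (three * 𝟙 (φ v ≡ᵇ c) *_) (sym (Pr≡𝔼 G DA (evEq G x (φ x))))))

  Pr-glued-∈-between : ∀ {v} → v ∈ S → ∀ c {lo hi} →
    (∀ c′ → c′ ∈ₗ L x → lo ≤ Pr G DA (evEq G x c′) × Pr G DA (evEq G x c′) ≤ hi) →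
    three * lo * Pr G DH (evEq G v c) ≤ Pr G glued (evEq G v c) ×
    Pr G glued (evEq G v c) ≤ three * hi * Pr G DH (evEq G v c)
  Pr-glued-∈-between {v} v∈S c {lo} {hi} DA-at-x =
    (begin
      three * lo * Pr G DH (evEq G v c)                 ≡⟨ scaled lo ⟨
      𝔼 (support DH) (λ φ → weight φ * lo)              ≤⟨ 𝔼-monoᴬ (nonneg DH) x-coloured (λ φ φx∈ →
                                                             mono φ (proj₁ (DA-at-x (φ x) φx∈))) ⟩
      𝔼 (support DH) (λ φ → weight φ * Pr-DA-at-x φ)    ≡⟨ Pr-glued-∈ v∈S c ⟨
      Pr G glued (evEq G v c)                           ∎) ,
    (begin
      Pr G glued (evEq G v c)                           ≡⟨ Pr-glued-∈ v∈S c ⟩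
      𝔼 (support DH) (λ φ → weight φ * Pr-DA-at-x φ)    ≤⟨ 𝔼-monoᴬ (nonneg DH) x-coloured (λ φ φx∈ →
                                                             mono φ (proj₂ (DA-at-x (φ x) φx∈))) ⟩
      𝔼 (support DH) (λ φ → weight φ * hi)              ≡⟨ scaled hi ⟩
      three * hi * Pr G DH (evEq G v c)                 ∎)
    where
    open ≤-Reasoning
    weight : Colouring → ℚ
    weight φ = three * 𝟙 (φ v ≡ᵇ c)
    Pr-DA-at-x : Colouring → ℚ
    Pr-DA-at-x φ = Pr G DA (evEq G x (φ x))
    x-coloured : All (λ p → proj₂ p x ∈ₗ L x) (support DH)
    x-coloured = All.map (λ φ-col → proj₁ φ-col x x∈H) (colouring DH)
    mono : ∀ φ {p q} → p ≤ q → weight φ * p ≤ weight φ * q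
    mono φ = *-monoˡ-≤-≥0 (weight φ) (0≤* 0≤three (0≤𝟙 (φ v ≡ᵇ c)))
    scaled : ∀ β → 𝔼 (support DH) (λ φ → weight φ * β) ≡ three * β * Pr G DH (evEq G v c)
    scaled β = trans (𝔼-cong (support DH) (λ φ → xy∙z≈xz∙y three (𝟙 (φ v ≡ᵇ c)) β))
                     (trans (𝔼-*ˡ (support DH) (three * β) (λ φ → 𝟙 (φ v ≡ᵇ c)))
                            (cong (three * β *_) (sym (Pr≡𝔼 G DH (evEq G v c)))))

  glued-EA : ∀ {ε α} → 0ℚ ≤ ε → α ≤ oneThird →
             (∀ v c → v ∈ ∁ S → c ∈ₗ L v → ε ≤ Pr G DA (evEq G v c)) →
             (∀ u c → u ∈ ∁ S → α ≤ Pr G DA (λ φ → not (evEq G u c φ))) →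
             EADistribution G ⊤ L ε α
  glued-EA {ε} {α} 0≤ε α≤⅓ fixA forbA = glued , fix , forbid
    where
    DA-at-x : ∀ c′ → c′ ∈ₗ L x → ε ≤ Pr G DA (evEq G x c′) × Pr G DA (evEq G x c′) ≤ 1ℚ ℚ.- α
    DA-at-x c′ c′∈ = fixA x c′ x∈∁S c′∈ ,
                     α≤Pr-not⇒Pr≤1-α G DA (evEq G x c′) (forbA x c′ x∈∁S)
    0≤1-α : 0ℚ ≤ 1ℚ ℚ.- α
    0≤1-α = p≤r-q⇒q≤r-p {r = 1ℚ} (≤-trans α≤⅓ (≤ᵇ⇒≤ _))

    fix : ∀ v c → v ∈ ⊤ → c ∈ₗ L v → ε ≤ Pr G glued (evEq G v c)
    fix v c _ c∈ with v ∈? S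
    ... | yes v∈S = begin
      ε                                 ≡⟨ three*p*⅓≡p ε ⟨
      three * ε * oneThird              ≤⟨ *-monoˡ-≤-≥0 (three * ε) (0≤* 0≤three 0≤ε)
                                             (fixH v c (x∈p-y⇒x∈p v∈S) c∈) ⟩
      three * ε * Pr G DH (evEq G v c)  ≤⟨ proj₁ (Pr-glued-∈-between v∈S c DA-at-x) ⟩
      Pr G glued (evEq G v c)           ∎
      where open ≤-Reasoning
    ... | no  v∉S =
      subst (ε ≤_) (sym (Pr-glued-∉ v∉S (_≡ᵇ c))) (fixA v c (x∉p⇒x∈∁p v∉S) c∈)

    forbid : ∀ u c → u ∈ ⊤ → α ≤ Pr G glued (λ φ → not (evEq G u c φ))
    forbid u c _ with u ∈? S
    ... | yes u∈S = Pr≤1-α⇒α≤Pr-not G glued (evEq G u c) (begin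
      Pr G glued (evEq G u c)                       ≤⟨ proj₂ (Pr-glued-∈-between u∈S c DA-at-x) ⟩
      three * (1ℚ ℚ.- α) * Pr G DH (evEq G u c)     ≤⟨ *-monoˡ-≤-≥0 (three * (1ℚ ℚ.- α)) (0≤* 0≤three 0≤1-α)
                                                         (Pr-colour≤⅓ G DH u∈H (L-3′ u) (λ c′ → fixH u c′ u∈H) c) ⟩
      three * (1ℚ ℚ.- α) * oneThird                 ≡⟨ three*p*⅓≡p (1ℚ ℚ.- α) ⟩
      1ℚ ℚ.- α                                      ∎)
      where
      open ≤-Reasoning
      u∈H : u ∈ H
      u∈H = x∈p-y⇒x∈p u∈S
    ... | no  u∉S =
      subst (α ≤_) (sym (Pr-glued-∉ u∉S (λ k → not (k ≡ᵇ c)))) (forbA u c (x∉p⇒x∈∁p u∉S))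

restrict-distribution : ∀ {n} {G : Graph n} {W W′ L} → W′ ⊆ W → Distribution G W L → Distribution G W′ L
restrict-distribution W′⊆W D = record
  { support = support D ; nonneg = nonneg D ; total = total D
  ; colouring = All.map (λ (∈L , proper) → (λ v v∈ → ∈L v (W′⊆W v∈)) ,
                                           (λ u v u∈ v∈ → proper u v (W′⊆W u∈) (W′⊆W v∈)))
                        (colouring D) }

whole-block-EA : ∀ {n} (G : Graph n) {H L} → (∀ y → y ∈ H) → IsAssignment G ⊤ (λ _ → 3) L →
                 (DH : Distribution G H L) →
                 (∀ v c → v ∈ H → c ∈ₗ L v → oneThird ≤ Pr G DH (evEq G v c)) →
                 ∀ {ε α} → ε ≤ α → α ≤ oneThird → EADistribution G ⊤ L ε α
whole-block-EA G {L = L} H-full L-3 DH fixH {ε} {α} ε≤α α≤⅓ = D , fix , forbid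
  where
  D : Distribution G ⊤ L
  D = restrict-distribution (λ {y} _ → H-full y) DH
  fix : ∀ v c → v ∈ ⊤ → c ∈ₗ L v → ε ≤ Pr G D (evEq G v c)
  fix v c _ c∈ = ≤-trans ε≤α (≤-trans α≤⅓ (fixH v c (H-full v) c∈))
  forbid : ∀ u c → u ∈ ⊤ → α ≤ Pr G D (λ φ → not (evEq G u c φ))
  forbid u c _ = Pr≤1-α⇒α≤Pr-not G D (evEq G u c)
    (≤-trans (Pr-colour≤⅓ G DH (H-full u) (L-3 u ∈⊤) (λ c′ → fixH u c′ (H-full u)) c)
             (p≤r-q⇒q≤r-p {r = 1ℚ} (≤-trans α≤⅓ (≤ᵇ⇒≤ _))))

lemma3p1 : ∀ {n : ℕ} (G : Graph n) (H : Subset n) →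
    Connected G ⊤ → TerminalBlock G H →
    Reductive G H (λ _ → 3) 3 oneThird →
    ∀ (ε α : ℚ) → 0ℚ < ε → ε ≤ α → α ≤ oneThird →
    Reducible G H ε α
lemma3p1 G H G-conn H-terminal@((((H-nonempty , _) , _) , _) , _) H-reductive ε α 0<ε ε≤α α≤⅓
  with terminal-block-attachment G G-conn H-terminal
... | inj₁ H-full = H , H-nonempty , id , λ L L-3 _ →
      let (DH , fixH , _) = H-reductive L (λ v _ → L-3 v ∈⊤) in
      whole-block-EA G H-full L-3 DH fixH ε≤α α≤⅓
... | inj₂ att = H - point , (other , other∈) , x∈p-y⇒x∈p , λ L L-3 (DA , fixA , forbA) →
      let (DH , fixH , _) = H-reductive L (λ v _ → L-3 v ∈⊤) in
      Gluing.glued-EA G att L-3 DH fixH DA (<⇒≤ 0<ε) α≤⅓ fixA forbA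
  where open Attachment att
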